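{- $\mathtt{Equality}_n$ requires $\mathsf{QCDCL}^{\textsf{LEV-ORD}}_{\textsf{RED}}$ refutations of size $2^n$.
   Context: $\mathtt{Equality}_n$ is the QCNF $\exists x_1\dots x_n\,\forall u_1\dots u_n\,\exists t_1\dots t_n\cdot(\bar t_1\vee\dots\vee\bar t_n)\wedge\bigwedge_{i=1}^n\big((\bar x_i\vee\bar u_i\vee t_i)\wedge(x_i\vee u_i\vee t_i)\big)$. Notions. For a QCNF $\Phi=\mathcal{Q}\cdot\phi$ with prefix $Q_1X_1\dots Q_sX_s$, $\mathrm{lv}(x)=i$ if the variable of $x$ is in $X_i$. $\mathrm{red}(C)$ deletes from $C$ every universal literal $v$ with $\mathrm{lv}(v)>\mathrm{lv}(x)$ for all existential $x\in C$; $(C_1\vee\ell)\otimes_\ell(C_2\vee\bar\ell)=C_1\vee C_2$ for existential $\ell$. $C|_\sigma=\top$ if $C\cap\sigma\neq\emptyset$, else the clause of $\ell\in C$ with $\bar\ell\notin\sigma$. A trail is $\mathcal{T}=(p_{(0,1)},\dots,p_{(0,g_0)};d_1,p_{(1,1)},\dots;\dots;d_r,\dots,p_{(r,g_r)})$, a sequence of literals with no variable occurring twice; $d_i$ decisions, $p_{(i,j)}$ propagated literals (existential, or $\bot$ only as last element: a conflict); $\mathcal{T}[s,t]$ is the initial segment ending at $p_{(s,t)}$ (at $d_s$ if $t=0$; $\mathcal{T}[0,0]$ empty); $|\mathcal{T}|$ its length. RED: each $p_{(i,j)}$ has antecedent $\mathrm{ante}(p_{(i,j)})$ in the current clause set with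 $\mathrm{red}(\mathrm{ante}(p_{(i,j)})|_{\mathcal{T}[i,j-1]})=(p_{(i,j)})$ ($(\bot)$ = empty clause). LEV-ORD: $\mathrm{lv}(d_i)\le\mathrm{lv}(x)$ for all variables $x$ unassigned in $\mathcal{T}[i-1,g_{i-1}]$. A clause is unit if its reduct is $(x)$ with $x$ existential or empty. Natural condition at an initial segment without $\bot$: if some clauses are unit under it, the next element is the literal of one of them with that clause as antecedent, and is $\bot$ if possible. Learnable clauses of a trail ending in $\bot$: start with $\mathrm{red}(\mathrm{ante}(\bot))$, go leftwards over propagated $p$: current $C'$ becomes $\mathrm{red}(C'\otimes_p\mathrm{red}(\mathrm{ante}(p)))$ if $\bar p\in C'$, else stays; $\mathcal{L}_\mathcal{T}$ is this sequence. A $\mathsf{QCDCL}^{\textsf{LEV-ORD}}_{\textsf{RED}}$ refutation of $\Phi$: trails $\mathcal{T}_1,\dots,\mathcal{T}_m$ and clauses $C_1,\dots,C_m=(\bot)$ (with derivations), $\mathcal{T}_i$ a LEV-ORD/RED trail for $\mathcal{Q}\cdot(\phi\cup\{C_1,\dots,C_{i-1}\})$ that has run into a conflict, $C_i\in\mathcal{L}_{\mathcal{T}_i}$, $\mathcal{T}_1$ satisfies the natural condition everywhere, and for $i\ge2$ some $(s,t)$ has $\mathcal{T}_i[s,t]=\mathcal{T}_{i-1}[s,t]$ with the natural condition for $\mathcal{T}_i$ at all initial segments extending $\mathcal{T}_i[s,t]$. Size $=\sum_i|\mathcal{T}_i|$. -}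

module Defs where

open import Data.Nat using (ℕ; zero; suc; _+_; _≤_; _≤ᵇ_; _^_)
open import Data.Bool using (Bool; true; false; not; _∧_; _∨_; if_then_else_)
import Data.Bool.Properties as BoolP
open import Data.Fin using (Fin)
import Data.Fin.Properties as FinP
open import Data.List using (List; []; _∷_; _++_; map; length; take; reverse; filterᵇ; allFin; concatMap)
open import Data.Bool.ListAction using (any)
open import Data.Nat.ListAction using (sum)
open import Data.List.Membership.Propositional using (_∈_; _∉_)
open import Data.List.Relation.Unary.Any using (Any)
open import Data.List.Relation.Unary.Unique.Propositional using (Unique)
open import Data.Maybe using (Maybe; just; nothing)
open import Data.Product using (Σ; _×_; _,_; proj₁; proj₂; ∃; ∃-syntax)
open import Data.Sum using (_⊎_)
open import Data.Unit using (⊤)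
open import Relation.Binary.PropositionalEquality using (_≡_; refl; cong)
open import Relation.Binary.Definitions using (DecidableEquality)
open import Relation.Nullary using (yes; no; ¬_)
open import Relation.Nullary.Decidable using (⌊_⌋; map′)
open import Data.Product.Properties using (≡-dec)

-- A prefix Q₁X₁ … QₛXₛ is given by assigning to each variable its
-- quantifier (isEx : true = existential, false = universal) and its block
-- index lv.  'vars' enumerates all variables of the formula.
-- A literal is a pair (variable , polarity) with polarity true = positive.
-- Clauses are lists of literals, read as sets (compared with _≈_ below).

record QCNF : Set₁ where
  field
    Var    : Set
    _≟V_   : DecidableEquality Var
    vars   : List Var
    isEx   : Var → Bool
    lv     : Var → ℕ
    matrix : List (List (Var × Bool))

module QCDCL (Φ : QCNF) where
  open QCNF Φ

  Lit : Set
  Lit = Var × Bool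

  Clause : Set
  Clause = List Lit

  neg : Lit → Lit
  neg (v , b) = (v , not b)

  exL : Lit → Bool
  exL l = isEx (proj₁ l)

  lvL : Lit → ℕ
  lvL l = lv (proj₁ l)

  _≟L_ : DecidableEquality Lit
  _≟L_ = ≡-dec _≟V_ BoolP._≟_

  _∈ᵇ_ : Lit → List Lit → Bool
  l ∈ᵇ σ = any (λ m → ⌊ l ≟L m ⌋) σ

  _≈_ : Clause → Clause → Set
  C ≈ D = (∀ l → l ∈ C → l ∈ D) × (∀ l → l ∈ D → l ∈ C)

  red : Clause → Clause
  red C = filterᵇ keep C
    where
    keep : Lit → Bool
    keep l = exL l ∨ any (λ y → exL y ∧ (lvL l ≤ᵇ lvL y)) C

  -- (C₁ ∨ ℓ̄) ⊗ (C₂ ∨ ℓ) = C₁ ∨ C₂ ; first argument contains ℓ̄, second ℓ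
  resolve : Lit → Clause → Clause → Clause
  resolve ℓ C D = filterᵇ (λ m → not ⌊ m ≟L neg ℓ ⌋) C ++ filterᵇ (λ m → not ⌊ m ≟L ℓ ⌋) D

  -- C|σ ; nothing stands for ⊤
  restrict : Clause → List Lit → Maybe Clause
  restrict C σ = if any (λ l → l ∈ᵇ σ) C then nothing
                 else just (filterᵇ (λ l → not (neg l ∈ᵇ σ)) C)

  ReducesTo : Clause → List Lit → Clause → Set
  ReducesTo C σ E = ∃[ D ] (restrict C σ ≡ just D × red D ≈ E)

  Unit : Clause → List Lit → Set
  Unit C σ = (∃[ x ] (exL x ≡ true × ReducesTo C σ (x ∷ []))) ⊎ ReducesTo C σ []

  data Step : Set where
    dec  : Lit → Step
    prop : Lit → Clause → Step

  litOf : Step → Lit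
  litOf (dec l)    = l
  litOf (prop l _) = l

  lits : List Step → List Lit
  lits = map litOf

  record ConflTrail : Set where
    constructor _⊢⊥_
    field
      body     : List Step
      conflAnt : Clause

  open ConflTrail public

  data Entry : Set where
    step     : Step → Entry
    conflict : Clause → Entry

  entries : ConflTrail → List Entry
  entries T = map step (body T) ++ conflict (conflAnt T) ∷ []

  len : ConflTrail → ℕ
  len T = length (entries T)

  data Label : Set where
    decL  : Lit → Label
    propL : Lit → Label
    botL  : Label

  label : Entry → Label
  label (step (dec l))    = decL l
  label (step (prop l _)) = propL l
  label (conflict _)      = botL

  shape : ConflTrail → List Label
  shape T = map label (entries T)

  -- validity of one step after the assignment σ, w.r.t. clause set F
  --   decisions: LEV-ORD ; propagations: RED, existential, antecedent in F
  ValidStep : List Clause → List Lit → Step → Set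
  ValidStep F σ (dec l) =
    ∀ x → x ∈ vars → x ∉ map proj₁ σ → lvL l ≤ lv x
  ValidStep F σ (prop l C) =
    C ∈ F × exL l ≡ true × ReducesTo C σ (l ∷ [])

  ValidSteps : List Clause → List Lit → List Step → Set
  ValidSteps F σ []       = ⊤
  ValidSteps F σ (s ∷ ss) = ValidStep F σ s × ValidSteps F (σ ++ litOf s ∷ []) ss

  TrailOK : List Clause → ConflTrail → Set
  TrailOK F T =
    Unique (map proj₁ (lits (body T))) ×
    ValidSteps F [] (body T) ×
    (conflAnt T ∈ F × ReducesTo (conflAnt T) (lits (body T)) [])

  isDec : Entry → Bool
  isDec (step (dec _)) = true
  isDec _              = false

  isConfl : Entry → Bool
  isConfl (conflict _) = true
  isConfl _            = false

  litsE : List Entry → List Lit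
  litsE []                   = []
  litsE (step s ∷ es)        = litOf s ∷ litsE es
  litsE (conflict _ ∷ es)    = litsE es

  Natural : List Clause → List Lit → Entry → Set
  Natural F σ e =
    (Any (λ C → Unit C σ) F →
       isDec e ≡ false ×
       (Any (λ C → ReducesTo C σ []) F → isConfl e ≡ true))

  NaturalFrom : List Clause → ℕ → ConflTrail → Set
  NaturalFrom F k T =
    ∀ pre e post → entries T ≡ pre ++ e ∷ post → k ≤ length pre →
    Natural F (litsE pre) e

  learnSeq : List Step → Clause → List Clause
  learnSeq []              C' = C' ∷ []
  learnSeq (dec _ ∷ ss)    C' = learnSeq ss C'
  learnSeq (prop p D ∷ ss) C' =
    C' ∷ learnSeq ss (if neg p ∈ᵇ C' then red (resolve p C' (red D)) else C')

  learnable : ConflTrail → List Clause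
  learnable T = learnSeq (reverse (body T)) (red (conflAnt T))

  record Round : Set where
    constructor round
    field
      trail   : ConflTrail
      learned : Clause

  open Round public

  RestartOK : List Clause → Maybe ConflTrail → ConflTrail → Set
  RestartOK F nothing   T = NaturalFrom F 0 T
  RestartOK F (just T') T =
    ∃[ k ] (k ≤ len T × k ≤ len T' × take k (shape T) ≡ take k (shape T') ×
            NaturalFrom F k T)

  ValidRounds : List Clause → Maybe ConflTrail → List Round → Set
  ValidRounds F prev []       = ⊤
  ValidRounds F prev (r ∷ rs) =
    TrailOK F (trail r) ×
    Any (λ C → learned r ≈ C) (learnable (trail r)) ×
    RestartOK F prev (trail r) ×
    ValidRounds (F ++ learned r ∷ []) (just (trail r)) rs

  record Refutation : Set where
    field
      rounds : List Round
      valid  : ValidRounds matrix nothing rounds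
      ends   : ∃[ rs ] ∃[ r ] (rounds ≡ rs ++ r ∷ [] × learned r ≈ [])

  size : Refutation → ℕ
  size π = sum (map (λ r → len (trail r)) (Refutation.rounds π))

data EqVar (n : ℕ) : Set where
  xv uv tv : Fin n → EqVar n

eqVar-≟ : ∀ {n} → DecidableEquality (EqVar n)
eqVar-≟ (xv i) (xv j) = map′ (cong xv) (λ { refl → refl }) (i FinP.≟ j)
eqVar-≟ (uv i) (uv j) = map′ (cong uv) (λ { refl → refl }) (i FinP.≟ j)
eqVar-≟ (tv i) (tv j) = map′ (cong tv) (λ { refl → refl }) (i FinP.≟ j)
eqVar-≟ (xv _) (uv _) = no λ ()
eqVar-≟ (xv _) (tv _) = no λ ()
eqVar-≟ (uv _) (xv _) = no λ ()
eqVar-≟ (uv _) (tv _) = no λ ()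
eqVar-≟ (tv _) (xv _) = no λ ()
eqVar-≟ (tv _) (uv _) = no λ ()

Equality : ℕ → QCNF
Equality n = record
  { Var    = EqVar n
  ; _≟V_   = eqVar-≟
  ; vars   = map xv (allFin n) ++ map uv (allFin n) ++ map tv (allFin n)
  ; isEx   = isEx
  ; lv     = lv
  ; matrix = map (λ i → (tv i , false)) (allFin n)
             ∷ concatMap (λ i → ((xv i , false) ∷ (uv i , false) ∷ (tv i , true) ∷ [])
                              ∷ ((xv i , true)  ∷ (uv i , true)  ∷ (tv i , true) ∷ [])
                              ∷ []) (allFin n)
  }
  where
  isEx : EqVar n → Bool
  isEx (xv _) = true
  isEx (uv _) = false
  isEx (tv _) = true
  lv : EqVar n → ℕ
  lv (xv _) = 1
  lv (uv _) = 2
  lv (tv _) = 3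

-- Fix α ∈ {0,1}ⁿ for the x-variables. For each ρ ≢ α, the assignment τ(α, ρ) with x = α, u = ρ and
-- tᵢ = (uᵢ == xᵢ) satisfies all clauses of Equality_n; call a clause valid for α if every such
-- τ(α, ρ) satisfies it. Resolution preserves validity, and so does universal reduction of a clause E
-- without complementary universal literals, unless α is the critical assignment falsifying all
-- universal literals of E. Under LEV-ORD no t is propagated before all x are assigned (for n ≥ 2), so
-- by RED every antecedent has its universal literals falsified by the trail, and hence the clauses met
-- during conflict analysis stay free of complementary universal literals. If α were critical at no
-- resolution step of any trail, every learned clause, the empty one included, would be valid for α.
-- So all 2ⁿ assignments occur among the critical ones, of which a trail of length L offers fewer than L.
module Submission where

open import Defs
open import Data.Bool using (Bool; true; false; not; T; _∧_; if_then_else_)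
open import Data.Bool.Properties as Boolₚ using (not-¬)
open import Data.Bool.ListAction using (any)
open import Data.Empty using (⊥; ⊥-elim)
open import Data.Fin using (Fin; zero; suc)
open import Data.List using (List; []; _∷_; _++_; map; length; reverse; filterᵇ; allFin; concatMap)
open import Data.List.Properties using (length-++; length-map; length-reverse; ++-assoc)
open import Data.List.Membership.Propositional using (_∈_; _∉_; find; lose)
open import Data.List.Membership.Propositional.Properties
  using (∈-filter⁺; ∈-filter⁻; ∈-++⁺ˡ; ∈-++⁺ʳ; ∈-++⁻; ∈-map⁺; ∈-map⁻; ∈-allFin; ∈-concatMap⁻)
import Data.List.Membership.DecPropositional as DecMembership
open import Data.List.Relation.Binary.Subset.Propositional using (_⊆_)
open import Data.List.Relation.Binary.Subset.Propositional.Properties using (Any-resp-⊆)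
open import Data.List.Relation.Unary.All as All using (All; []; _∷_)
open import Data.List.Relation.Unary.All.Properties using (++⁺)
open import Data.List.Relation.Unary.Any as Any using (Any; here; there)
import Data.List.Relation.Unary.Any.Properties as Anyₚ
open import Data.List.Relation.Unary.AllPairs using (_∷_)
open import Data.List.Relation.Unary.Unique.Propositional using (Unique)
open import Data.Maybe using (just; nothing)
open import Data.Nat using (ℕ; zero; suc; _+_; _≤_; _≤ᵇ_; _^_; z≤n; s≤s)
open import Data.Nat.ListAction using (sum)
open import Data.Nat.Properties using (+-suc; +-comm; +-identityʳ; +-mono-≤; ≤-refl; ≤-trans; m≤m+n; m≤n⇒m≤1+n; module ≤-Reasoning)
open import Data.Product using (_×_; _,_; proj₁; proj₂; ∃-syntax; map₁; map₂)
open import Data.Sum using (_⊎_; inj₁; inj₂)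
open import Data.Unit using (⊤; tt)
open import Data.Vec using (Vec; []; _∷_; lookup; tabulate) renaming (map to mapᵥ)
import Data.Vec.Properties as Vecₚ
open import Function using (_∘_; case_of_)
open import Relation.Binary.PropositionalEquality using (_≡_; _≢_; refl; sym; trans; cong; cong₂; subst; module ≡-Reasoning)
open import Relation.Nullary using (yes; no; ¬_; does)
open import Relation.Nullary.Decidable using (⌊_⌋; toWitness; fromWitness; toWitnessFalse; fromWitnessFalse; dec-false)
open import Relation.Nullary.Reflects using (Reflects; ofʸ; ofⁿ; fromEquivalence)

-- Lists containing every Boolean vector

splitByHead : ∀ {k} → List (Vec Bool (suc k)) → List (Vec Bool k) × List (Vec Bool k)
splitByHead []                = [] , []
splitByHead ((true  ∷ v) ∷ L) = map₁ (v ∷_) (splitByHead L)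
splitByHead ((false ∷ v) ∷ L) = map₂ (v ∷_) (splitByHead L)

length-splitByHead : ∀ {k} (L : List (Vec Bool (suc k))) →
                     length (proj₁ (splitByHead L)) + length (proj₂ (splitByHead L)) ≡ length L
length-splitByHead []                = refl
length-splitByHead ((true  ∷ v) ∷ L) = cong suc (length-splitByHead L)
length-splitByHead ((false ∷ v) ∷ L) = trans (+-suc _ _) (cong suc (length-splitByHead L))

∈-splitByHead-true : ∀ {k} {v : Vec Bool k} L → (true ∷ v) ∈ L → v ∈ proj₁ (splitByHead L)
∈-splitByHead-true ((true  ∷ w) ∷ L) (here refl) = here refl
∈-splitByHead-true ((true  ∷ w) ∷ L) (there v∈) = there (∈-splitByHead-true L v∈)
∈-splitByHead-true ((false ∷ w) ∷ L) (there v∈) = ∈-splitByHead-true L v∈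

∈-splitByHead-false : ∀ {k} {v : Vec Bool k} L → (false ∷ v) ∈ L → v ∈ proj₂ (splitByHead L)
∈-splitByHead-false ((false ∷ w) ∷ L) (here refl) = here refl
∈-splitByHead-false ((false ∷ w) ∷ L) (there v∈) = there (∈-splitByHead-false L v∈)
∈-splitByHead-false ((true  ∷ w) ∷ L) (there v∈) = ∈-splitByHead-false L v∈

exhaustive⇒2^k≤length : ∀ k (L : List (Vec Bool k)) → (∀ v → v ∈ L) → 2 ^ k ≤ length L
exhaustive⇒2^k≤length zero    []      complete with () ← complete []
exhaustive⇒2^k≤length zero    (_ ∷ _) _        = s≤s z≤n
exhaustive⇒2^k≤length (suc k) L       complete = begin
  2 ^ k + (2 ^ k + 0)                                      ≡⟨ cong (2 ^ k +_) (+-identityʳ (2 ^ k)) ⟩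
  2 ^ k + 2 ^ k                                            ≤⟨ +-mono-≤ (exhaustive⇒2^k≤length k _ trues)
                                                                        (exhaustive⇒2^k≤length k _ falses) ⟩
  length (proj₁ (splitByHead L)) + length (proj₂ (splitByHead L)) ≡⟨ length-splitByHead L ⟩
  length L                                                 ∎
  where
  open ≤-Reasoning
  trues : ∀ v → v ∈ proj₁ (splitByHead L)
  trues v = ∈-splitByHead-true L (complete (true ∷ v))
  falses : ∀ v → v ∈ proj₂ (splitByHead L)
  falses v = ∈-splitByHead-false L (complete (false ∷ v))

∃-lookup-≢ : ∀ {k} {u v : Vec Bool k} → u ≢ v → ∃[ i ] lookup u i ≢ lookup v i
∃-lookup-≢ {u = []}    {[]}    u≢v = ⊥-elim (u≢v refl)
∃-lookup-≢ {u = a ∷ u} {b ∷ v} u≢v with a Boolₚ.≟ b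
... | no a≢b = zero , a≢b
... | yes refl with i , d ← ∃-lookup-≢ (u≢v ∘ cong (a ∷_)) = suc i , d

module _ {Φ : QCNF} where
  open QCDCL Φ

  len≡suc-length-body : ∀ T → len T ≡ suc (length (body T))
  len≡suc-length-body T = begin
    length (map step (body T) ++ conflict (conflAnt T) ∷ [])  ≡⟨ length-++ (map step (body T)) ⟩
    length (map step (body T)) + 1                            ≡⟨ cong (_+ 1) (length-map step (body T)) ⟩
    length (body T) + 1                                       ≡⟨ +-comm (length (body T)) 1 ⟩
    suc (length (body T))                                     ∎
    where open ≡-Reasoning

  suc-≤-len : ∀ {k} T → k ≤ length (body T) → suc k ≤ len T
  suc-≤-len T k≤ = subst (suc _ ≤_) (sym (len≡suc-length-body T)) (s≤s k≤)

  size-≥-first-trail : ∀ {k} → (∀ T → TrailOK (QCNF.matrix Φ) T → k ≤ len T) →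
                       ∀ π → k ≤ size π
  size-≥-first-trail {k} bound π = go (Refutation.rounds π) (Refutation.valid π) (Refutation.ends π)
    where
    go : ∀ rs → ValidRounds (QCNF.matrix Φ) nothing rs → ∃[ rs′ ] ∃[ r ] (rs ≡ rs′ ++ r ∷ [] × learned r ≈ []) →
         k ≤ sum (map (len ∘ trail) rs)
    go []      _          ([]    , _ , () , _)
    go []      _          (_ ∷ _ , _ , () , _)
    go (r ∷ _) (ok , _) _ = ≤-trans (bound (trail r) ok) (m≤m+n _ _)

module EqualityRefutations (n : ℕ) where
  open QCDCL (Equality n)
  open DecMembership _≟L_ using (_∈?_)
  open DecMembership (Vecₚ.≡-dec {n = n} Boolₚ._≟_) using () renaming (_∈?_ to _∈ᵥ?_)

  -- Restriction and universal reduction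

  ∈ᵇ⁻ : ∀ {l} σ → T (l ∈ᵇ σ) → l ∈ σ
  ∈ᵇ⁻ σ l∈ᵇσ = Any.map toWitness (Anyₚ.any⁻ _ σ l∈ᵇσ)

  ∈ᵇ⁺ : ∀ {l σ} → l ∈ σ → T (l ∈ᵇ σ)
  ∈ᵇ⁺ l∈σ = Anyₚ.any⁺ _ (Any.map fromWitness l∈σ)

  ∈ᵇ-reflects : ∀ l σ → Reflects (l ∈ σ) (l ∈ᵇ σ)
  ∈ᵇ-reflects l σ = fromEquivalence (∈ᵇ⁻ σ) ∈ᵇ⁺

  restrict≡just⇒disjoint : ∀ {C σ D} → restrict C σ ≡ just D → ∀ {l} → l ∈ C → l ∉ σ
  restrict≡just⇒disjoint {C} {σ} _ with any (λ l → l ∈ᵇ σ) C in noneSatisfied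
  restrict≡just⇒disjoint {C} {σ} refl | false =
    λ l∈C l∈σ → subst T noneSatisfied (Anyₚ.any⁺ _ (lose l∈C (∈ᵇ⁺ l∈σ)))

  ∈-restrict⁺ : ∀ {C σ D l} → restrict C σ ≡ just D → l ∈ C → neg l ∉ σ → l ∈ D
  ∈-restrict⁺ {C} {σ} {l = l} _ l∈C nl∉σ with any (λ l → l ∈ᵇ σ) C
  ∈-restrict⁺ {C} {σ} {l = l} refl l∈C nl∉σ | false = ∈-filter⁺ _ l∈C kept
    where
    kept : T (not (neg l ∈ᵇ σ))
    kept with neg l ∈ᵇ σ | ∈ᵇ-reflects (neg l) σ
    ... | true  | ofʸ nl∈σ = nl∉σ nl∈σ
    ... | false | _        = tt

  ∈-restrict⁻ : ∀ {C σ D l} → restrict C σ ≡ just D → l ∈ D → l ∈ C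
  ∈-restrict⁻ {C} {σ} _ l∈D with any (λ l → l ∈ᵇ σ) C
  ∈-restrict⁻ {C} {σ} refl l∈D | false = proj₁ (∈-filter⁻ _ l∈D)

  HasT : Clause → Set
  HasT C = ∃[ j ] ∃[ b ] (tv j , b) ∈ C

  ∈-red⁻ : ∀ {C l} → l ∈ red C → l ∈ C
  ∈-red⁻ l∈ = proj₁ (∈-filter⁻ _ l∈)

  ∈-red⁺ : ∀ {C l} → exL l ≡ true → l ∈ C → l ∈ red C
  ∈-red⁺ {l = xv _ , _} _ l∈C = ∈-filter⁺ _ l∈C _
  ∈-red⁺ {l = tv _ , _} _ l∈C = ∈-filter⁺ _ l∈C _

  -- a t-literal has the innermost level, so it blocks the reduction of every universal literal
  HasT⇒⊆red : ∀ {C} → HasT C → C ⊆ red C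
  HasT⇒⊆red _               {xv _ , _} l∈C = ∈-red⁺ refl l∈C
  HasT⇒⊆red _               {tv _ , _} l∈C = ∈-red⁺ refl l∈C
  HasT⇒⊆red (_ , _ , t∈C) {uv _ , _} l∈C = ∈-filter⁺ _ l∈C (Anyₚ.any⁺ _ (lose t∈C _))

  universal∈red⇒HasT : ∀ {C i b} → (uv i , b) ∈ red C → HasT C
  universal∈red⇒HasT {C} u∈
    with find (Anyₚ.any⁻ (λ y → exL y ∧ (2 ≤ᵇ lvL y)) C (proj₂ (∈-filter⁻ _ {xs = C} u∈)))
  ... | (tv j , c) , t∈C , _ = j , c , t∈C
  ... | (xv _ , _) , _   , ()
  ... | (uv _ , _) , _   , ()

  -- Clause invariants

  UFree : Clause → Set
  UFree C = ∀ {i b} → (uv i , b) ∉ C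

  NonTautU : Clause → Set
  NonTautU C = ∀ {i} → (uv i , true) ∈ C → (uv i , false) ∉ C

  Wide : Clause → Set
  Wide C = UFree C → ∀ {j b} → (tv j , b) ∈ C → b ≡ false × (∀ k → (tv k , false) ∈ C)

  Reduced : Clause → Set
  Reduced C = ∀ {i b} → (uv i , b) ∈ C → HasT C

  record Good (C : Clause) : Set where
    field
      nonTautU : NonTautU C
      wide     : Wide C
      reduced  : Reduced C

  Reduced⇒⊆red : ∀ {C} → Reduced C → C ⊆ red C
  Reduced⇒⊆red reduced {xv _ , _} l∈C = ∈-red⁺ refl l∈C
  Reduced⇒⊆red reduced {tv _ , _} l∈C = ∈-red⁺ refl l∈C
  Reduced⇒⊆red reduced {uv _ , _} l∈C = HasT⇒⊆red (reduced l∈C) l∈C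

  Reduced-red : ∀ C → Reduced (red C)
  Reduced-red C u∈ with j , c , t∈C ← universal∈red⇒HasT {C} u∈ = j , c , ∈-red⁺ refl t∈C

  Wide-red : ∀ {C} → Wide C → Wide (red C)
  Wide-red {C} wide uFree t∈ = map₂ (λ all k → ∈-red⁺ refl (all k)) (wide uFreeC (∈-red⁻ t∈))
    where
    uFreeC : UFree C
    uFreeC u∈C = uFree (HasT⇒⊆red (_ , _ , ∈-red⁻ t∈) u∈C)

  Good-≈ : ∀ {C D} → C ≈ D → Good D → Good C
  Good-≈ (C⊆D , D⊆C) good = record
    { nonTautU = λ u⁺∈ u⁻∈ → nonTautU (C⊆D _ u⁺∈) (C⊆D _ u⁻∈)
    ; wide     = λ uFree t∈ → map₂ (λ all k → D⊆C _ (all k)) (wide (uFree ∘ D⊆C _) (C⊆D _ t∈))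
    ; reduced  = λ u∈ → let j , c , t∈ = reduced (C⊆D _ u∈) in j , c , D⊆C _ t∈
    }
    where open Good good

  ∈-resolve⁺ˡ : ∀ p C D {l} → l ∈ C → l ≢ neg p → l ∈ resolve p C D
  ∈-resolve⁺ˡ _ _ _ l∈C l≢ = ∈-++⁺ˡ (∈-filter⁺ _ l∈C (fromWitnessFalse l≢))

  ∈-resolve⁺ʳ : ∀ p C D {l} → l ∈ D → l ≢ p → l ∈ resolve p C D
  ∈-resolve⁺ʳ p C _ l∈D l≢ =
    ∈-++⁺ʳ (filterᵇ (λ m → not ⌊ m ≟L neg p ⌋) C) (∈-filter⁺ _ l∈D (fromWitnessFalse l≢))

  ∈-resolve⁻ : ∀ p C D {l} → l ∈ resolve p C D → (l ∈ C × l ≢ neg p) ⊎ (l ∈ D × l ≢ p)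
  ∈-resolve⁻ p C D l∈ with ∈-++⁻ (filterᵇ (λ m → not ⌊ m ≟L neg p ⌋) C) l∈
  ... | inj₁ l∈C′ = inj₁ (map₂ toWitnessFalse (∈-filter⁻ _ {xs = C} l∈C′))
  ... | inj₂ l∈D′ = inj₂ (map₂ toWitnessFalse (∈-filter⁻ _ {xs = D} l∈D′))

  -- The models τ(α, ρ)

  -- tᵢ is the least value satisfying both clauses of index i, so t̄₁ ∨ … ∨ t̄ₙ holds exactly when ρ ≢ α.
  model : Vec Bool n → Vec Bool n → EqVar n → Bool
  model α ρ (xv i) = lookup α i
  model α ρ (uv i) = lookup ρ i
  model α ρ (tv i) = does (lookup ρ i Boolₚ.≟ lookup α i)

  _⊨_ : (EqVar n → Bool) → Clause → Set
  f ⊨ C = Any (λ l → f (proj₁ l) ≡ proj₂ l) C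

  Valid : Vec Bool n → Clause → Set
  Valid α C = ∀ ρ → ρ ≢ α → model α ρ ⊨ C

  Valid-mono : ∀ {α C D} → C ⊆ D → Valid α C → Valid α D
  Valid-mono C⊆D valid ρ ρ≢α = Any-resp-⊆ C⊆D (valid ρ ρ≢α)

  ⊨-resolve : ∀ {f} p C D → f ⊨ C → f ⊨ D → f ⊨ resolve p C D
  ⊨-resolve p C D f⊨C f⊨D with find f⊨C
  ... | l , l∈C , fl with l ≟L neg p
  ... | no l≢ = lose (∈-resolve⁺ˡ p C D l∈C l≢) fl
  ... | yes refl with find f⊨D
  ... | l′ , l′∈D , fl′ with l′ ≟L p
  ... | no l′≢ = lose (∈-resolve⁺ʳ p C D l′∈D l′≢) fl′
  ... | yes refl = ⊥-elim (not-¬ fl′ fl)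

  falsifyingU : Clause → Vec Bool n
  falsifyingU C = tabulate (λ i → not ((uv i , true) ∈ᵇ C))

  falsifyingU-falsifies : ∀ {C i b} → NonTautU C → (uv i , b) ∈ C → lookup (falsifyingU C) i ≢ b
  falsifyingU-falsifies {C} {i} nonTautU u∈C
    rewrite Vecₚ.lookup∘tabulate (λ i → not ((uv i , true) ∈ᵇ C)) i
    with (uv i , true) ∈ᵇ C | ∈ᵇ-reflects (uv i , true) C
  ... | true  | ofʸ u⁺∈C = λ { refl → nonTautU u⁺∈C u∈C }
  ... | false | ofⁿ u⁺∉C = λ { refl → u⁺∉C u∈C }

  -- Only the literal satisfying E at the critical point ρ = falsifyingU E matters:
  -- it is not universal, an x-literal does not depend on ρ, and a t-literal blocks all reduction.
  Valid-red : ∀ {α E} → Valid α E → NonTautU E → falsifyingU E ≢ α → Valid α (red E)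
  Valid-red {α} {E} valid nonTautU critical≢α ρ ρ≢α with find (valid (falsifyingU E) critical≢α)
  ... | (xv i , b) , x∈E , holds = lose (∈-red⁺ refl x∈E) holds
  ... | (tv i , b) , t∈E , _     = Any-resp-⊆ (HasT⇒⊆red (i , b , t∈E)) (valid ρ ρ≢α)
  ... | (uv i , b) , u∈E , holds = ⊥-elim (falsifyingU-falsifies nonTautU u∈E holds)

  T̄ : Clause
  T̄ = map (λ i → (tv i , false)) (allFin n)

  data MatrixClause : Clause → Set where
    all-t̄ : MatrixClause T̄
    x̄ūt   : ∀ i → MatrixClause ((xv i , false) ∷ (uv i , false) ∷ (tv i , true) ∷ [])
    xut   : ∀ i → MatrixClause ((xv i , true)  ∷ (uv i , true)  ∷ (tv i , true) ∷ [])

  matrixClause : ∀ {C} → C ∈ QCNF.matrix (Equality n) → MatrixClause C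
  matrixClause (here refl) = all-t̄
  matrixClause (there C∈) with find (∈-concatMap⁻ (λ i → ((xv i , false) ∷ (uv i , false) ∷ (tv i , true) ∷ [])
                                                         ∷ ((xv i , true)  ∷ (uv i , true)  ∷ (tv i , true) ∷ [])
                                                         ∷ []) {xs = allFin n} C∈)
  ... | i , _ , here refl         = x̄ūt i
  ... | i , _ , there (here refl) = xut i

  ∈-T̄⁻ : ∀ {l} → l ∈ T̄ → ∃[ k ] l ≡ (tv k , false)
  ∈-T̄⁻ l∈ with k , _ , refl ← ∈-map⁻ (λ i → (tv i , false)) l∈ = k , refl

  ∈-T̄⁺ : ∀ k → (tv k , false) ∈ T̄
  ∈-T̄⁺ k = ∈-map⁺ (λ i → (tv i , false)) (∈-allFin k)

  matrix-good : ∀ {C} → MatrixClause C → Good C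
  matrix-good all-t̄ = record
    { nonTautU = λ u∈ → case ∈-T̄⁻ u∈ of λ ()
    ; wide     = λ _ t∈ → case ∈-T̄⁻ t∈ of λ { (_ , refl) → refl , ∈-T̄⁺ }
    ; reduced  = λ u∈ → case ∈-T̄⁻ u∈ of λ ()
    }
  matrix-good (x̄ūt i) = record
    { nonTautU = λ { (there (there (here ()))) ; (there (there (there ()))) }
    ; wide     = λ uFree _ → ⊥-elim (uFree (there (here refl)))
    ; reduced  = λ _ → i , true , there (there (here refl))
    }
  matrix-good (xut i) = record
    { nonTautU = λ _ → λ { (there (there (here ()))) ; (there (there (there ()))) }
    ; wide     = λ uFree _ → ⊥-elim (uFree (there (here refl)))
    ; reduced  = λ _ → i , true , there (there (here refl))
    }

  matrix-valid : ∀ α {C} → MatrixClause C → Valid α C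
  matrix-valid α all-t̄ ρ ρ≢α with i , ρᵢ≢αᵢ ← ∃-lookup-≢ ρ≢α =
    lose (∈-T̄⁺ i) (dec-false (lookup ρ i Boolₚ.≟ lookup α i) ρᵢ≢αᵢ)
  matrix-valid α (x̄ūt i) ρ _ with lookup α i in αᵢ | lookup ρ i in ρᵢ
  ... | false | _     = here αᵢ
  ... | true  | false = there (here ρᵢ)
  ... | true  | true  = there (there (here (cong₂ (λ r a → does (r Boolₚ.≟ a)) ρᵢ αᵢ)))
  matrix-valid α (xut i) ρ _ with lookup α i in αᵢ | lookup ρ i in ρᵢ
  ... | true  | _     = here αᵢ
  ... | false | true  = there (here ρᵢ)
  ... | false | false = there (there (here (cong₂ (λ r a → does (r Boolₚ.≟ a)) ρᵢ αᵢ)))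

  UFree-resolveˡ : ∀ p C D → exL p ≡ true → UFree (resolve p C D) → UFree C
  UFree-resolveˡ p@(xv _ , _) C D _ uFree u∈C = uFree (∈-resolve⁺ˡ p C D u∈C λ ())
  UFree-resolveˡ p@(tv _ , _) C D _ uFree u∈C = uFree (∈-resolve⁺ˡ p C D u∈C λ ())

  UFree-resolveʳ : ∀ p C D → exL p ≡ true → UFree (resolve p C D) → UFree D
  UFree-resolveʳ p@(xv _ , _) C D _ uFree u∈D = uFree (∈-resolve⁺ʳ p C D u∈D λ ())
  UFree-resolveʳ p@(tv _ , _) C D _ uFree u∈D = uFree (∈-resolve⁺ʳ p C D u∈D λ ())

  -- A t-pivot cannot be resolved away without a universal literal remaining:
  -- universal-free wide clauses contain negative t-literals only.
  Wide-resolve : ∀ p C D → exL p ≡ true → neg p ∈ C → p ∈ D → Wide C → Wide D → Reduced D →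
                 Wide (resolve p C (red D))
  Wide-resolve p@(xv _ , _) C D ex _ _ wideC wideD reducedD uFree t∈ with ∈-resolve⁻ p C (red D) t∈
  ... | inj₁ (t∈C , _)    = map₂ (λ all k → ∈-resolve⁺ˡ p C (red D) (all k) λ ())
                                 (wideC (UFree-resolveˡ p C (red D) ex uFree) t∈C)
  ... | inj₂ (t∈redD , _) = map₂ (λ all k → ∈-resolve⁺ʳ p C (red D) (∈-red⁺ refl (all k)) λ ())
                                 (wideD (UFree-resolveʳ p C (red D) ex uFree ∘ Reduced⇒⊆red reducedD) (∈-red⁻ t∈redD))
  Wide-resolve p@(tv _ , c) C D ex np∈C p∈D wideC wideD reducedD uFree _ =
    case subst (λ b → not b ≡ false) c≡false not-c≡false of λ ()
    where
    c≡false : c ≡ false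
    c≡false = proj₁ (wideD (UFree-resolveʳ p C (red D) ex uFree ∘ Reduced⇒⊆red reducedD) p∈D)
    not-c≡false : not c ≡ false
    not-c≡false = proj₁ (wideC (UFree-resolveˡ p C (red D) ex uFree) np∈C)

  -- Trails of Equality_n

  IsX : Lit → Set
  IsX (xv _ , _) = ⊤
  IsX (uv _ , _) = ⊥
  IsX (tv _ , _) = ⊥

  XOnly : List Lit → Set
  XOnly σ = ∀ {l} → l ∈ σ → IsX l

  Unassigned : EqVar n → List Lit → Set
  Unassigned v σ = ∀ {b} → (v , b) ∉ σ

  XFirst : List Lit → Set
  XFirst σ = ∀ {i} → Unassigned (xv i) σ → XOnly σ

  UFalsified : List Lit → Clause → Set
  UFalsified σ C = ∀ {i b} → (uv i , b) ∈ C → (uv i , not b) ∈ σ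

  Unassigned⇒∉vars : ∀ {v σ} → Unassigned v σ → v ∉ map proj₁ σ
  Unassigned⇒∉vars unassigned v∈ with _ , l∈σ , refl ← ∈-map⁻ proj₁ v∈ = unassigned l∈σ

  Unique⇒Unassigned : ∀ (σ : List Lit) {l τ} → Unique (map proj₁ (σ ++ l ∷ τ)) → Unassigned (proj₁ l) σ
  Unique⇒Unassigned (_ ∷ σ) (fresh ∷ _) (here refl) = All.lookup fresh (∈-map⁺ proj₁ (∈-++⁺ʳ σ (here refl))) refl
  Unique⇒Unassigned (_ ∷ σ) (_ ∷ unique) (there l∈) = Unique⇒Unassigned σ unique l∈

  Unique⇒consistent : ∀ (σ : List Lit) {v b c} → Unique (map proj₁ σ) → (v , b) ∈ σ → (v , c) ∈ σ → b ≡ c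
  Unique⇒consistent (_ ∷ _) _              (here refl) (here refl) = refl
  Unique⇒consistent (_ ∷ _) (fresh ∷ _)    (here refl) (there l∈)  = ⊥-elim (All.lookup fresh (∈-map⁺ proj₁ l∈) refl)
  Unique⇒consistent (_ ∷ _) (fresh ∷ _)    (there l∈)  (here refl) = ⊥-elim (All.lookup fresh (∈-map⁺ proj₁ l∈) refl)
  Unique⇒consistent (_ ∷ σ) (_ ∷ unique)   (there l∈)  (there l′∈) = Unique⇒consistent σ unique l∈ l′∈

  reduct∈ : ∀ {C σ l} → ReducesTo C σ (l ∷ []) → l ∈ C
  reduct∈ {σ = σ} (_ , restricted , _ , ⊇l) = ∈-restrict⁻ {σ = σ} restricted (∈-red⁻ (⊇l _ (here refl)))

  existential-survives : ∀ {C σ l m} → ReducesTo C σ (l ∷ []) → m ∈ C → neg m ∉ σ → exL m ≡ true → m ≡ l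
  existential-survives {σ = σ} (_ , restricted , ⊆l , _) m∈C nm∉σ ex
    with here m≡l ← ⊆l _ (∈-red⁺ ex (∈-restrict⁺ {σ = σ} restricted m∈C nm∉σ)) = m≡l

  survives-beside-t : ∀ {C σ j c m} → ReducesTo C σ ((tv j , c) ∷ []) → m ∈ C → neg m ∉ σ → m ≡ (tv j , c)
  survives-beside-t {σ = σ} (_ , restricted , ⊆t , ⊇t) m∈C nm∉σ
    with here m≡t ← ⊆t _ (HasT⇒⊆red (_ , _ , ∈-red⁻ (⊇t _ (here refl))) (∈-restrict⁺ {σ = σ} restricted m∈C nm∉σ)) = m≡t

  learnStep : Lit → Clause → Clause → Clause
  learnStep p D C′ = if neg p ∈ᵇ C′ then red (resolve p C′ (red D)) else C′

  -- one per propagation step: the critical assignment of the resolvent formed there, if any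
  candidatesFrom : List Step → Clause → List (Vec Bool n)
  candidatesFrom []              C′ = []
  candidatesFrom (dec _ ∷ ss)    C′ = candidatesFrom ss C′
  candidatesFrom (prop p D ∷ ss) C′ = falsifyingU (resolve p C′ (red D)) ∷ candidatesFrom ss (learnStep p D C′)

  candidates : ConflTrail → List (Vec Bool n)
  candidates T = candidatesFrom (reverse (body T)) (red (conflAnt T))

  module Trails (another : (j : Fin n) → ∃[ k ] k ≢ j) {F : List Clause} (good : All Good F) where

    -- the clause D would contain some t̄ k with k ≢ j as a second surviving literal
    no-early-t-propagation : ∀ {σ D j c} → XOnly σ → D ∈ F → ¬ ReducesTo D σ ((tv j , c) ∷ [])
    no-early-t-propagation {σ} {D} {j} xOnly D∈F reducesTo =
      k≢j (tv-injective (existential-survives {D} {σ} reducesTo (t̄∈D k) xOnly refl))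
      where
      open Good (All.lookup good D∈F)
      k : Fin n
      k = proj₁ (another j)
      k≢j : k ≢ j
      k≢j = proj₂ (another j)
      tv-injective : ∀ {k j b c} → _≡_ {A = Lit} (tv k , b) (tv j , c) → k ≡ j
      tv-injective refl = refl
      uFree : UFree D
      uFree u∈D = case survives-beside-t {D} {σ} reducesTo u∈D xOnly of λ ()
      t̄∈D : ∀ k → (tv k , false) ∈ D
      t̄∈D = proj₂ (wide uFree (reduct∈ {D} {σ} reducesTo))

    -- LEV-ORD forbids deciding u or t while some xᵢ is open, and t cannot be propagated yet.
    XFirst-step : ∀ {σ} s → XFirst σ → ValidStep F σ s → XFirst (σ ++ litOf s ∷ [])
    XFirst-step {σ} s xFirst valid {i} unassigned l∈ = case ∈-++⁻ σ l∈ of λ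
      { (inj₁ l∈σ)         → xOnly l∈σ
      ; (inj₂ (here refl)) → new s valid
      }
      where
      xOnly : XOnly σ
      xOnly = xFirst (unassigned ∘ ∈-++⁺ˡ)
      decision-level≤1 : ∀ {l} → ValidStep F σ (dec l) → lvL l ≤ 1
      decision-level≤1 levOrd = levOrd (xv i) (∈-++⁺ˡ (∈-map⁺ xv (∈-allFin i))) (Unassigned⇒∉vars (unassigned ∘ ∈-++⁺ˡ))
      new : ∀ s → ValidStep F σ s → IsX (litOf s)
      new (dec (xv _ , _))    _                      = tt
      new (dec (uv j , b))    levOrd                 = case decision-level≤1 {uv j , b} levOrd of λ { (s≤s ()) }
      new (dec (tv j , b))    levOrd                 = case decision-level≤1 {tv j , b} levOrd of λ { (s≤s ()) }
      new (prop (xv _ , _) _) _                      = tt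
      new (prop (uv _ , _) _) (_ , () , _)
      new (prop (tv _ , _) _) (D∈F , _ , reducesTo) = no-early-t-propagation xOnly D∈F reducesTo

    Justified : List Lit → Step → Set
    Justified σ (dec _)    = ⊤
    Justified σ (prop p D) = D ∈ F × exL p ≡ true × p ∈ D × UFalsified σ (red D)

    -- For an x-propagation red D has no universal literal at all: D's t-literal would survive in the reduct.
    antecedent-UFalsified : ∀ {σ p D} → XFirst σ → Unassigned (proj₁ p) σ → ValidStep F σ (prop p D) →
                            UFalsified σ (red D)
    antecedent-UFalsified {σ} {xv _ , _} {D} xFirst unassigned (_ , _ , reducesTo) u∈
      with _ , _ , t∈D ← universal∈red⇒HasT {D} u∈ =
      case existential-survives {D} {σ} reducesTo t∈D (xFirst unassigned) refl of λ ()
    antecedent-UFalsified {σ} {uv _ , _} _ _ (_ , () , _)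
    antecedent-UFalsified {σ} {tv _ , _} {D} _ _ (_ , _ , reducesTo) {i} {b} u∈ with (uv i , not b) ∈? σ
    ... | yes ū∈σ = ū∈σ
    ... | no  ū∉σ = case survives-beside-t {D} {σ} reducesTo (∈-red⁻ u∈) ū∉σ of λ ()

    steps-justified : ∀ {σT σ} ss → σ ++ lits ss ≡ σT → Unique (map proj₁ σT) → XFirst σ → ValidSteps F σ ss →
                      ∀ {s} → s ∈ ss → Justified σT s
    steps-justified (dec _ ∷ _) _ _ _ _ (here refl) = tt
    steps-justified {σT} {σ} (prop p D ∷ ss) σ++≡ unique xFirst (valid@(D∈F , ex , reducesTo) , _) (here refl) =
      D∈F , ex , reduct∈ {D} {σ} reducesTo , σ⊆σT ∘ antecedent-UFalsified xFirst unassigned valid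
      where
      σ⊆σT : σ ⊆ σT
      σ⊆σT l∈ = subst (_ ∈_) σ++≡ (∈-++⁺ˡ l∈)
      unassigned : Unassigned (proj₁ p) σ
      unassigned = Unique⇒Unassigned σ (subst (Unique ∘ map proj₁) (sym σ++≡) unique)
    steps-justified {σ = σ} (s′ ∷ ss) σ++≡ unique xFirst (valid , valids) (there s∈) =
      steps-justified ss (trans (++-assoc σ (litOf s′ ∷ []) (lits ss)) σ++≡) unique (XFirst-step s′ xFirst valid) valids s∈

    module Learning {T : ConflTrail} (ok : TrailOK F T) where
      σT : List Lit
      σT = lits (body T)

      ca : Clause
      ca = conflAnt T

      unique : Unique (map proj₁ σT)
      unique = proj₁ ok

      ca∈F : ca ∈ F
      ca∈F = proj₁ (proj₂ (proj₂ ok))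

      open Good (All.lookup good ca∈F) renaming (nonTautU to nonTautU-ca; wide to wide-ca; reduced to reduced-ca)

      ca∩σT≡∅ : ∀ {l} → l ∈ ca → l ∉ σT
      ca∩σT≡∅ = restrict≡just⇒disjoint {ca} {σT} (proj₁ (proj₂ (proj₂ (proj₂ (proj₂ ok)))))

      justified : ∀ {s} → s ∈ reverse (body T) → Justified σT s
      justified = steps-justified (body T) refl unique (λ _ ()) (proj₁ (proj₂ ok)) ∘ Anyₚ.reverse⁻

      FromTrailOrConflict : Clause → Set
      FromTrailOrConflict C = ∀ {i b} → (uv i , b) ∈ C → (uv i , not b) ∈ σT ⊎ (uv i , b) ∈ ca

      record Invariant (C : Clause) : Set where
        field
          origin  : FromTrailOrConflict C
          wide    : Wide C
          reduced : Reduced C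

      FromTrailOrConflict⇒NonTautU : ∀ {C} → FromTrailOrConflict C → NonTautU C
      FromTrailOrConflict⇒NonTautU origin u⁺∈C u⁻∈C with origin u⁺∈C | origin u⁻∈C
      ... | inj₁ u⁻∈σT | inj₁ u⁺∈σT = case Unique⇒consistent σT unique u⁻∈σT u⁺∈σT of λ ()
      ... | inj₁ u⁻∈σT | inj₂ u⁻∈ca = ca∩σT≡∅ u⁻∈ca u⁻∈σT
      ... | inj₂ u⁺∈ca | inj₁ u⁺∈σT = ca∩σT≡∅ u⁺∈ca u⁺∈σT
      ... | inj₂ u⁺∈ca | inj₂ u⁻∈ca = nonTautU-ca u⁺∈ca u⁻∈ca

      Invariant-red : ∀ {C} → FromTrailOrConflict C → Wide C → Invariant (red C)
      Invariant-red {C} origin wide = record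
        { origin  = origin ∘ ∈-red⁻
        ; wide    = Wide-red wide
        ; reduced = Reduced-red C
        }

      FromTrailOrConflict-resolve : ∀ {p D C′} → UFalsified σT (red D) → FromTrailOrConflict C′ →
                                    FromTrailOrConflict (resolve p C′ (red D))
      FromTrailOrConflict-resolve {p} {D} {C′} uFalsified origin u∈ with ∈-resolve⁻ p C′ (red D) u∈
      ... | inj₁ (u∈C′ , _)   = origin u∈C′
      ... | inj₂ (u∈redD , _) = inj₁ (uFalsified u∈redD)

      Invariant-learnStep : ∀ {p D C′} → Justified σT (prop p D) → Invariant C′ → Invariant (learnStep p D C′)
      Invariant-learnStep {p} {D} {C′} (D∈F , ex , p∈D , uFalsified) inv
        with neg p ∈ᵇ C′ | ∈ᵇ-reflects (neg p) C′
      ... | false | _        = inv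
      ... | true  | ofʸ np∈C′ = Invariant-red (FromTrailOrConflict-resolve {p} {D} {C′} uFalsified origin)
                                              (Wide-resolve p C′ D ex np∈C′ p∈D wide (Good.wide goodD) (Good.reduced goodD))
        where
        open Invariant inv
        goodD : Good D
        goodD = All.lookup good D∈F

      Invariant-initial : Invariant (red ca)
      Invariant-initial = Invariant-red inj₂ wide-ca

      learnSeq-invariant : ∀ ss {C′} → (∀ {s} → s ∈ ss → Justified σT s) → Invariant C′ →
                           ∀ {C} → C ∈ learnSeq ss C′ → Invariant C
      learnSeq-invariant []              _         inv (here refl) = inv
      learnSeq-invariant (dec _ ∷ ss)    justifies inv C∈          = learnSeq-invariant ss (justifies ∘ there) inv C∈
      learnSeq-invariant (prop _ _ ∷ ss) _         inv (here refl) = inv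
      learnSeq-invariant (prop _ _ ∷ ss) justifies inv (there C∈)  =
        learnSeq-invariant ss (justifies ∘ there) (Invariant-learnStep (justifies (here refl)) inv) C∈

      learnable-good : ∀ {C} → C ∈ learnable T → Good C
      learnable-good C∈ = record
        { nonTautU = FromTrailOrConflict⇒NonTautU origin
        ; wide     = wide
        ; reduced  = reduced
        }
        where open Invariant (learnSeq-invariant (reverse (body T)) justified Invariant-initial C∈)

      module _ {α} (validF : All (Valid α) F) where

        Valid-learnStep : ∀ {p D C′} → Justified σT (prop p D) → Invariant C′ → Valid α C′ →
                          falsifyingU (resolve p C′ (red D)) ≢ α → Valid α (learnStep p D C′)
        Valid-learnStep {p} {D} {C′} (D∈F , _ , _ , uFalsified) inv valid critical≢α with neg p ∈ᵇ C′
        ... | false = valid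
        ... | true  = Valid-red validResolvent nonTautU critical≢α
          where
          validResolvent : Valid α (resolve p C′ (red D))
          validResolvent ρ ρ≢α = ⊨-resolve p C′ (red D) (valid ρ ρ≢α)
            (Valid-mono (Reduced⇒⊆red (Good.reduced (All.lookup good D∈F))) (All.lookup validF D∈F) ρ ρ≢α)
          nonTautU : NonTautU (resolve p C′ (red D))
          nonTautU = FromTrailOrConflict⇒NonTautU
                       (FromTrailOrConflict-resolve {p} {D} {C′} uFalsified (Invariant.origin inv))

        learnSeq-valid : ∀ ss {C′} → (∀ {s} → s ∈ ss → Justified σT s) → Invariant C′ → Valid α C′ →
                         α ∉ candidatesFrom ss C′ → ∀ {C} → C ∈ learnSeq ss C′ → Valid α C
        learnSeq-valid []              _         _   valid _  (here refl) = valid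
        learnSeq-valid (dec _ ∷ ss)    justifies inv valid α∉ C∈          =
          learnSeq-valid ss (justifies ∘ there) inv valid α∉ C∈
        learnSeq-valid (prop _ _ ∷ ss) _         _   valid _  (here refl) = valid
        learnSeq-valid (prop _ _ ∷ ss) justifies inv valid α∉ (there C∈)  =
          learnSeq-valid ss (justifies ∘ there) (Invariant-learnStep (justifies (here refl)) inv)
            (Valid-learnStep (justifies (here refl)) inv valid (α∉ ∘ here ∘ sym)) (α∉ ∘ there) C∈

        learnable-valid : α ∉ candidates T → ∀ {C} → C ∈ learnable T → Valid α C
        learnable-valid = learnSeq-valid (reverse (body T)) justified Invariant-initial
          (Valid-mono (Reduced⇒⊆red reduced-ca) (All.lookup validF ca∈F))

  candidatesOf : List Round → List (Vec Bool n)
  candidatesOf = concatMap (candidates ∘ trail)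

  learned-valid : (another : (j : Fin n) → ∃[ k ] k ≢ j) → ∀ {F prev rs α} →
                  All Good F → ValidRounds F prev rs → All (Valid α) F → α ∉ candidatesOf rs →
                  All (Valid α ∘ learned) rs
  learned-valid _       {rs = []}    _    _                               _      _  = []
  learned-valid another {rs = r ∷ _} {α} good (ok , learnable∋ , _ , valids) validF α∉ =
    valid-r ∷ learned-valid another (++⁺ good (good-r ∷ [])) valids (++⁺ validF (valid-r ∷ []))
                (α∉ ∘ ∈-++⁺ʳ (candidates (trail r)))
    where
    open Trails another good
    open Learning ok
    C : Clause
    C = proj₁ (find learnable∋)
    C∈ : C ∈ learnable (trail r)
    C∈ = proj₁ (proj₂ (find learnable∋))
    r≈C : learned r ≈ C
    r≈C = proj₂ (proj₂ (find learnable∋))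
    good-r : Good (learned r)
    good-r = Good-≈ r≈C (learnable-good C∈)
    valid-r : Valid α (learned r)
    valid-r = Valid-mono (proj₂ r≈C _) (learnable-valid validF (α∉ ∘ ∈-++⁺ˡ) C∈)

  -- Counting critical assignments

  flip≢ : Fin n → ∀ (α : Vec Bool n) → mapᵥ not α ≢ α
  flip≢ i α flip≡α = not-¬ refl (sym (trans (sym (Vecₚ.lookup-map i not α)) (cong (λ v → lookup v i) flip≡α)))

  empty-clause-invalid : Fin n → ∀ α → ¬ Valid α []
  empty-clause-invalid i α valid = case valid (mapᵥ not α) (flip≢ i α) of λ ()

  last-learned-invalid : Fin n → ∀ α (π : Refutation) → ¬ All (Valid α ∘ learned) (Refutation.rounds π)
  last-learned-invalid i α π allValid with rs , r , rounds≡ , r≈[] ← Refutation.ends π =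
    empty-clause-invalid i α (Valid-mono (proj₁ r≈[] _) (All.lookup allValid r∈))
    where
    r∈ : r ∈ Refutation.rounds π
    r∈ = subst (r ∈_) (sym rounds≡) (∈-++⁺ʳ rs (here refl))

  every-assignment-critical : (another : (j : Fin n) → ∃[ k ] k ≢ j) → Fin n →
                              (π : Refutation) → ∀ α → α ∈ candidatesOf (Refutation.rounds π)
  every-assignment-critical another i π α with α ∈ᵥ? candidatesOf (Refutation.rounds π)
  ... | yes α∈ = α∈
  ... | no  α∉ = ⊥-elim (last-learned-invalid i α π
                   (learned-valid another (All.tabulate (matrix-good ∘ matrixClause)) (Refutation.valid π)
                                  (All.tabulate (matrix-valid α ∘ matrixClause)) α∉))

  length-candidatesFrom : ∀ ss C′ → length (candidatesFrom ss C′) ≤ length ss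
  length-candidatesFrom []              _  = z≤n
  length-candidatesFrom (dec _ ∷ ss)    C′ = m≤n⇒m≤1+n (length-candidatesFrom ss C′)
  length-candidatesFrom (prop p D ∷ ss) C′ = s≤s (length-candidatesFrom ss (learnStep p D C′))

  length-candidates : ∀ T → length (candidates T) ≤ len T
  length-candidates T = begin
    length (candidates T)          ≤⟨ length-candidatesFrom (reverse (body T)) (red (conflAnt T)) ⟩
    length (reverse (body T))      ≡⟨ length-reverse (body T) ⟩
    length (body T)                ≤⟨ m≤n⇒m≤1+n ≤-refl ⟩
    suc (length (body T))          ≡⟨ len≡suc-length-body T ⟨
    len T                          ∎
    where open ≤-Reasoning

  length-candidatesOf : ∀ rs → length (candidatesOf rs) ≤ sum (map (len ∘ trail) rs)
  length-candidatesOf []       = z≤n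
  length-candidatesOf (r ∷ rs) = begin
    length (candidates (trail r) ++ candidatesOf rs)         ≡⟨ length-++ (candidates (trail r)) ⟩
    length (candidates (trail r)) + length (candidatesOf rs) ≤⟨ +-mono-≤ (length-candidates (trail r)) (length-candidatesOf rs) ⟩
    len (trail r) + sum (map (len ∘ trail) rs)               ∎
    where open ≤-Reasoning

  2^n≤size : (another : (j : Fin n) → ∃[ k ] k ≢ j) → Fin n → ∀ π → 2 ^ n ≤ size π
  2^n≤size another i π = ≤-trans
    (exhaustive⇒2^k≤length n _ (every-assignment-critical another i π))
    (length-candidatesOf (Refutation.rounds π))

  matrix-HasT : Fin n → ∀ {C} → MatrixClause C → HasT C
  matrix-HasT i all-t̄    = i , false , ∈-T̄⁺ i
  matrix-HasT _ (x̄ūt i) = i , true , there (there (here refl))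
  matrix-HasT _ (xut i)  = i , true , there (there (here refl))

  -- every input clause has a t-literal, so none is falsified by the empty assignment
  first-trail-nonempty : Fin n → ∀ T → TrailOK (QCNF.matrix (Equality n)) T → 1 ≤ length (body T)
  first-trail-nonempty _ ((_ ∷ _) ⊢⊥ _) _ = s≤s z≤n
  first-trail-nonempty i ([] ⊢⊥ ca) (_ , _ , ca∈ , _ , restricted , red⊆[] , _)
    with _ , _ , t∈ca ← matrix-HasT i (matrixClause ca∈) =
    case red⊆[] _ (∈-red⁺ refl (∈-restrict⁺ {σ = []} restricted t∈ca λ ())) of λ ()

corollary5p9 : ∀ (n : ℕ) (π : QCDCL.Refutation (Equality n)) →
               2 ^ n ≤ QCDCL.size (Equality n) π
-- For n ≤ 1 the bound only asks for a nonempty (first) trail.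
corollary5p9 zero          = size-≥-first-trail λ T _ → suc-≤-len T z≤n
corollary5p9 (suc zero)    = size-≥-first-trail λ T ok → suc-≤-len T (EqualityRefutations.first-trail-nonempty 1 zero T ok)
corollary5p9 (suc (suc m)) = EqualityRefutations.2^n≤size (suc (suc m)) another zero
  where
  another : (j : Fin (suc (suc m))) → ∃[ k ] k ≢ j
  another zero    = suc zero , λ ()
  another (suc _) = zero , λ ()
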